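{- Let $\mathbf x$ be an infinite word over a finite alphabet which is not ultimately periodic and satisfies $\liminf_{n\to\infty} p(n,\mathbf x)/n < 2$. Then for each $n \ge 1$ there exists a unique essential right-special word of length $n$ in $\mathbf x$.
   Context: $p(n,\mathbf x)$ is the number of distinct factors of length $n$ of $\mathbf x$. A factor $w$ of $\mathbf x$ is right-special if there exist distinct letters $c,d$ with $wc$ and $wd$ factors of $\mathbf x$. A right-special factor $w$ is essential if $w$ is a suffix of right-special factors of $\mathbf x$ of arbitrarily large length. -}

module Defs where

open import Data.Nat using (ℕ; zero; suc; _+_; _*_; _≤_; _<_; _≥_)
open import Data.Fin using (Fin; toℕ)
open import Data.Vec using (Vec; lookup; _∷ʳ_; _++_)
open import Data.List using (List; length)
open import Data.List.Membership.Propositional using (_∈_)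
open import Data.List.Relation.Unary.Unique.Propositional using (Unique)
open import Data.Product using (Σ; ∃; ∃-syntax; _×_; _,_)
open import Function.Bundles using (_⇔_)
open import Relation.Binary.PropositionalEquality using (_≡_; _≢_)
open import Relation.Nullary using (¬_)

Word : ℕ → Set
Word k = ℕ → Fin k

UltimatelyPeriodic : ∀ {k} → Word k → Set
UltimatelyPeriodic x = ∃[ p ] ∃[ N ] (1 ≤ p × (∀ i → N ≤ i → x (i + p) ≡ x i))

IsFactor : ∀ {k n} → Word k → Vec (Fin k) n → Set
IsFactor {n = n} x w = ∃[ i ] (∀ (j : Fin n) → lookup w j ≡ x (i + toℕ j))

-- p(n, x) = m : there is a duplicate-free list of exactly the factors of
-- length n of x, and it has m elements.
Complexity : ∀ {k} → Word k → ℕ → ℕ → Set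
Complexity {k} x n m =
  Σ (List (Vec (Fin k) n)) λ L →
    Unique L × length L ≡ m × (∀ w → (w ∈ L) ⇔ IsFactor x w)

-- liminf_{n→∞} p(n,x)/n < 2 : there is a rational a/b < 2 such that
-- p(n,x)/n < a/b for infinitely many n.
LiminfComplexityRatioLt2 : ∀ {k} → Word k → Set
LiminfComplexityRatioLt2 x =
  ∃[ a ] ∃[ b ] (1 ≤ b × a < 2 * b ×
    (∀ N → ∃[ n ] (N ≤ n × 1 ≤ n × ∃[ m ] (Complexity x n m × b * m < a * n))))

RightSpecial : ∀ {k n} → Word k → Vec (Fin k) n → Set
RightSpecial {k} x w =
  ∃[ c ] ∃[ d ] (c ≢ d × IsFactor x (w ∷ʳ c) × IsFactor x (w ∷ʳ d))

EssentialRightSpecial : ∀ {k n} → Word k → Vec (Fin k) n → Set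
EssentialRightSpecial {k} {n} x w =
  RightSpecial x w ×
  (∀ L → ∃[ m ] Σ (Vec (Fin k) m) λ u → L ≤ m + n × RightSpecial x (u ++ w))

{-# OPTIONS --safe #-}
-- Right-special factors exist at every length: otherwise every factor of some length ℓ would
-- determine the letter following it, and the word would be ultimately periodic. Two distinct
-- right-special factors of length ℓ force p(ℓ + 1) ≥ p(ℓ) + 2, so if this happened at every
-- length in [n, N) then p(N) ≥ 2(N - n), contradicting p(N) < (a/b) N with a/b < 2 for suitable
-- large N. Hence some length d + n carries a unique right-special factor. Suffixes of
-- right-special factors are right-special, so every right-special factor of length at least
-- d + n ends with that one, hence with its suffix w of length n: w is essential, and every
-- essential right-special word of length n is a suffix of such a long factor, hence equals w.
module Submission where

open import Defs
open import Data.Empty using (⊥-elim)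
open import Data.Fin using (Fin; toℕ; zero; suc)
open import Data.Fin.Properties using (any?; pigeonhole; injective⇒≤)
  renaming (_≟_ to _≟ᶠ_)
open import Data.List as List using (List; []; _∷_; length; map; upTo; deduplicate)
open import Data.List.Membership.Propositional using (_∈_; _∉_; lose)
import Data.List.Membership.DecPropositional as DecMembership
open import Data.List.Membership.Propositional.Properties
  using (∈-lookup; ∈-map⁺; ∈-map⁻; ∈-upTo⁺; ∈-deduplicate⁺; ∈-deduplicate⁻)
open import Data.List.Membership.Setoid.Properties using (index-injective)
open import Data.List.Properties using (length-map)
open import Data.List.Relation.Binary.Subset.Propositional using (_⊆_)
open import Data.List.Relation.Unary.All as All using (All; []; _∷_)
open import Data.List.Relation.Unary.All.Properties using (¬Any⇒All¬)
open import Data.List.Relation.Unary.Any as Any using (Any; here; there; index; satisfied)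
open import Data.List.Relation.Unary.Unique.Propositional using (Unique; _∷_)
open import Data.List.Relation.Unary.Unique.DecPropositional.Properties using (deduplicate-!)
open import Data.List.Relation.Unary.Unique.Propositional.Properties using (map⁺)
open import Data.Nat using (ℕ; zero; suc; _+_; _*_; _∸_; _≤_; _<_; z≤n; s≤s)
open import Data.Nat.Properties
open import Data.Nat.Tactic.RingSolver using (solve-∀)
open import Data.Product using (Σ; ∃; ∃₂; _×_; _,_; proj₁; proj₂)
open import Data.Vec using (Vec; []; _∷_; _∷ʳ_; _++_; lookup; tabulate)
open import Data.Vec.Properties
  using ( tabulate∘lookup; tabulate-cong; ∷-injectiveʳ; ∷ʳ-injective; ∷ʳ-injectiveˡ
        ; ++-injectiveˡ; ++-injectiveʳ)
  renaming (≡-dec to ≡-decᵛ)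
open import Function.Bundles using (Equivalence)
open import Relation.Binary.PropositionalEquality
open import Relation.Binary.Definitions using (DecidableEquality)
open import Relation.Nullary using (¬_; Dec; yes; no)
open import Relation.Nullary.Decidable using (_×-dec_; ¬?; map′; decidable-stable)

module _ {A : Set} where

  Unique⇒lookup-injective : ∀ {xs : List A} → Unique xs →
                            ∀ {s t} → List.lookup xs s ≡ List.lookup xs t → s ≡ t
  Unique⇒lookup-injective (_ ∷ _)  {zero}  {zero}  _  = refl
  Unique⇒lookup-injective (x∉ ∷ _) {zero}  {suc t} eq = ⊥-elim (All.lookup x∉ (∈-lookup t) eq)
  Unique⇒lookup-injective (x∉ ∷ _) {suc s} {zero}  eq = ⊥-elim (All.lookup x∉ (∈-lookup s) (sym eq))
  Unique⇒lookup-injective (_ ∷ u)  {suc s} {suc t} eq = cong suc (Unique⇒lookup-injective u eq)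

  Unique∧⊆⇒length≤ : ∀ {xs ys : List A} → Unique xs → xs ⊆ ys → length xs ≤ length ys
  Unique∧⊆⇒length≤ u xs⊆ys = injective⇒≤ λ eq →
    Unique⇒lookup-injective u (index-injective (setoid A) (xs⊆ys (∈-lookup _)) (xs⊆ys (∈-lookup _)) eq)

a*[D+n]≤b*m : ∀ {a b n D m} → a < 2 * b → a * n ≤ D → 2 * D ≤ m → a * (D + n) ≤ b * m
a*[D+n]≤b*m {a} {b} {n} {D} {m} a<2b an≤D 2D≤m = begin
  a * (D + n)   ≡⟨ *-distribˡ-+ a D n ⟩
  a * D + a * n ≤⟨ +-monoʳ-≤ (a * D) an≤D ⟩
  a * D + D     ≡⟨ +-comm (a * D) D ⟩
  suc a * D     ≤⟨ *-monoˡ-≤ D a<2b ⟩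
  2 * b * D     ≡⟨ cong (_* D) (*-comm 2 b) ⟩
  b * 2 * D     ≡⟨ *-assoc b 2 D ⟩
  b * (2 * D)   ≤⟨ *-monoʳ-≤ b 2D≤m ⟩
  b * m         ∎
  where open ≤-Reasoning

module _ {k : ℕ} (x : Word k) where

  _≟ᵛ_ : ∀ {ℓ} → DecidableEquality (Vec (Fin k) ℓ)
  _≟ᵛ_ = ≡-decᵛ _≟ᶠ_

  factorAt : ℕ → (ℓ : ℕ) → Vec (Fin k) ℓ
  factorAt i zero    = []
  factorAt i (suc ℓ) = x i ∷ factorAt (suc i) ℓ

  lookup-factorAt : ∀ i {ℓ} (t : Fin ℓ) → lookup (factorAt i ℓ) t ≡ x (i + toℕ t)
  lookup-factorAt i zero    = cong x (sym (+-identityʳ i))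
  lookup-factorAt i (suc t) = trans (lookup-factorAt (suc i) t) (cong x (sym (+-suc i (toℕ t))))

  factorAt-isFactor : ∀ i ℓ → IsFactor x (factorAt i ℓ)
  factorAt-isFactor i ℓ = i , lookup-factorAt i

  isFactor⇒factorAt : ∀ {ℓ} {v : Vec (Fin k) ℓ} → IsFactor x v → ∃ λ i → v ≡ factorAt i ℓ
  isFactor⇒factorAt {v = v} (i , occ) = i , (begin
    v                                ≡⟨ tabulate∘lookup v ⟨
    tabulate (lookup v)              ≡⟨ tabulate-cong (λ t → trans (occ t) (sym (lookup-factorAt i t))) ⟩
    tabulate (lookup (factorAt i _)) ≡⟨ tabulate∘lookup _ ⟩
    factorAt i _                     ∎)
    where open ≡-Reasoning

  factorAt-++ : ∀ i m n → factorAt i m ++ factorAt (i + m) n ≡ factorAt i (m + n)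
  factorAt-++ i zero    n = cong (λ j → factorAt j n) (+-identityʳ i)
  factorAt-++ i (suc m) n = cong (x i ∷_)
    (trans (cong (λ j → factorAt (suc i) m ++ factorAt j n) (+-suc i m)) (factorAt-++ (suc i) m n))

  factorAt-∷ʳ : ∀ i ℓ → factorAt i ℓ ∷ʳ x (i + ℓ) ≡ factorAt i (suc ℓ)
  factorAt-∷ʳ i zero    = cong (λ c → c ∷ []) (cong x (+-identityʳ i))
  factorAt-∷ʳ i (suc ℓ) = cong (x i ∷_)
    (trans (cong (λ j → factorAt (suc i) ℓ ∷ʳ x j) (+-suc i ℓ)) (factorAt-∷ʳ (suc i) ℓ))

  isFactor-∷ʳ : ∀ i ℓ → IsFactor x (factorAt i ℓ ∷ʳ x (i + ℓ))
  isFactor-∷ʳ i ℓ = subst (IsFactor x) (sym (factorAt-∷ʳ i ℓ)) (factorAt-isFactor i (suc ℓ))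

  isFactor-∷ʳ⁻ : ∀ {ℓ} {v : Vec (Fin k) ℓ} {c} → IsFactor x (v ∷ʳ c) →
                 ∃ λ i → v ≡ factorAt i ℓ × c ≡ x (i + ℓ)
  isFactor-∷ʳ⁻ {ℓ} {v} f with i , vc≡ ← isFactor⇒factorAt f =
    i , ∷ʳ-injective v (factorAt i ℓ) (trans vc≡ (sym (factorAt-∷ʳ i ℓ)))

  isFactor-extendable : ∀ {ℓ} {v : Vec (Fin k) ℓ} → IsFactor x v → ∃ λ c → IsFactor x (v ∷ʳ c)
  isFactor-extendable {ℓ} {v} f with i , refl ← isFactor⇒factorAt {v = v} f =
    x (i + ℓ) , isFactor-∷ʳ i ℓ

  Agree : ℕ → ℕ → ℕ → Set
  Agree ℓ i j = factorAt i ℓ ≡ factorAt j ℓ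

  Agree-suffix : ∀ m {n i j} → Agree (m + n) i j → Agree n (i + m) (j + m)
  Agree-suffix m {n} {i} {j} ag = ++-injectiveʳ (factorAt i m) (factorAt j m)
    (trans (factorAt-++ i m n) (trans ag (sym (factorAt-++ j m n))))

  Agree-≤ : ∀ {ℓ m i j} → ℓ ≤ m → Agree m i j → Agree ℓ i j
  Agree-≤ {ℓ} {i = i} {j} ℓ≤m ag with o , refl ← m≤n⇒∃[o]m+o≡n ℓ≤m =
    ++-injectiveˡ (factorAt i ℓ) (factorAt j ℓ)
      (trans (factorAt-++ i ℓ o) (trans ag (sym (factorAt-++ j ℓ o))))

  Agree-step : ∀ {ℓ i j} → Agree ℓ i j → x (i + ℓ) ≡ x (j + ℓ) → Agree ℓ (suc i) (suc j)
  Agree-step {ℓ} {i} {j} ag e = ∷-injectiveʳ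
    (trans (sym (factorAt-∷ʳ i ℓ)) (trans (cong₂ _∷ʳ_ ag e) (factorAt-∷ʳ j ℓ)))

  determined⇒ultimatelyPeriodic : ∀ {ℓ s t} → (∀ {i j} → Agree ℓ i j → x (i + ℓ) ≡ x (j + ℓ)) →
                                 s < t → Agree ℓ s t → UltimatelyPeriodic x
  determined⇒ultimatelyPeriodic {ℓ} {s} determined s<t ag
    with o , refl ← m≤n⇒∃[o]m+o≡n s<t = suc o , s + ℓ , s≤s z≤n , periodic
    where
    agree-forever : ∀ r → Agree ℓ (r + s) (r + suc (s + o))
    agree-forever zero    = ag
    agree-forever (suc r) = Agree-step (agree-forever r) (determined (agree-forever r))

    shuffle₁ : ∀ s ℓ r → (s + ℓ) + r ≡ (r + s) + ℓ
    shuffle₁ = solve-∀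
    shuffle₂ : ∀ s ℓ r o → (r + suc (s + o)) + ℓ ≡ ((s + ℓ) + r) + suc o
    shuffle₂ = solve-∀

    periodic : ∀ y → s + ℓ ≤ y → x (y + suc o) ≡ x y
    periodic y s+ℓ≤y with r , refl ← m≤n⇒∃[o]m+o≡n s+ℓ≤y = sym
      (trans (cong x (shuffle₁ s ℓ r))
        (trans (determined (agree-forever r)) (cong x (shuffle₂ s ℓ r o))))

  RightSpecialAt : ℕ → ℕ → ℕ → Set
  RightSpecialAt ℓ i j = Agree ℓ i j × x (i + ℓ) ≢ x (j + ℓ)

  RightSpecialAt-suffix : ∀ m {n i j} → RightSpecialAt (m + n) i j → RightSpecialAt n (i + m) (j + m)
  RightSpecialAt-suffix m {n} {i} {j} (ag , ≢) = Agree-suffix m ag ,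
    λ e → ≢ (trans (cong x (sym (+-assoc i m n))) (trans e (cong x (+-assoc j m n))))

  rightSpecialAt⇒rightSpecial : ∀ {ℓ i j} → RightSpecialAt ℓ i j → RightSpecial x (factorAt i ℓ)
  rightSpecialAt⇒rightSpecial {ℓ} {i} {j} (ag , ≢) = x (i + ℓ) , x (j + ℓ) , ≢ , isFactor-∷ʳ i ℓ ,
    subst (λ v → IsFactor x (v ∷ʳ x (j + ℓ))) (sym ag) (isFactor-∷ʳ j ℓ)

  rightSpecial⇒rightSpecialAt : ∀ {ℓ} {v : Vec (Fin k) ℓ} → RightSpecial x v →
                                ∃₂ λ i j → v ≡ factorAt i ℓ × RightSpecialAt ℓ i j
  rightSpecial⇒rightSpecialAt (c , d , c≢d , fc , fd)
    with i , v≡i , c≡ ← isFactor-∷ʳ⁻ fc | j , v≡j , d≡ ← isFactor-∷ʳ⁻ fd =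
    i , j , v≡i , trans (sym v≡i) v≡j , λ e → c≢d (trans c≡ (trans e (sym d≡)))

  rightSpecial⇒isFactor : ∀ {ℓ} {v : Vec (Fin k) ℓ} → RightSpecial x v → IsFactor x v
  rightSpecial⇒isFactor {v = v} rs with i , _ , v≡ , _ ← rightSpecial⇒rightSpecialAt {v = v} rs =
    subst (IsFactor x) (sym v≡) (factorAt-isFactor i _)

  TwoRightSpecials : ℕ → Set
  TwoRightSpecials ℓ = ∃₂ λ (u v : Vec (Fin k) ℓ) → u ≢ v × RightSpecial x u × RightSpecial x v

  AtMostOneRightSpecial : ℕ → Set
  AtMostOneRightSpecial ℓ = ∀ {u v : Vec (Fin k) ℓ} → RightSpecial x u → RightSpecial x v → u ≡ v

  ¬twoRightSpecials⇒atMostOne : ∀ {ℓ} → ¬ TwoRightSpecials ℓ → AtMostOneRightSpecial ℓ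
  ¬twoRightSpecials⇒atMostOne ¬two {u} {v} ru rv =
    decidable-stable (u ≟ᵛ v) (λ u≢v → ¬two (u , v , u≢v , ru , rv))

  OccurBefore : ℕ → ℕ → Set
  OccurBefore ℓ B = ∀ i → ∃ λ j → j < B × Agree ℓ i j

  occurrenceBound : ∀ {ℓ} (vs : List (Vec (Fin k) ℓ)) → All (IsFactor x) vs →
                    ∃ λ B → All (λ v → ∃ λ j → j < B × v ≡ factorAt j ℓ) vs
  occurrenceBound [] [] = 0 , []
  occurrenceBound (v ∷ vs) (fv ∷ fvs)
    with i , v≡ ← isFactor⇒factorAt {v = v} fv | B , occ ← occurrenceBound vs fvs =
    suc i + B , (i , s≤s (m≤m+n i B) , v≡) ∷
      All.map (λ (j , j<B , e) → j , <-≤-trans j<B (m≤n+m B (suc i)) , e) occ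

  complexity⇒occurBefore : ∀ {ℓ m} → Complexity x ℓ m → ∃ (OccurBefore ℓ)
  complexity⇒occurBefore {ℓ} (L , _ , _ , L⇔)
    with B , occ ← occurrenceBound L (All.tabulate (Equivalence.to (L⇔ _))) =
    B , λ i → All.lookup occ (Equivalence.from (L⇔ _) (factorAt-isFactor i ℓ))

  liminf⇒occurBefore : LiminfComplexityRatioLt2 x → ∀ ℓ → ∃ (OccurBefore ℓ)
  liminf⇒occurBefore (_ , _ , _ , _ , often) ℓ
    with N , ℓ≤N , _ , _ , cx , _ ← often ℓ
    with B , before ← complexity⇒occurBefore cx =
    B , λ i → let j , j<B , ag = before i in j , j<B , Agree-≤ ℓ≤N ag

  -- Constructively, finiteness of the set of factors of each length has to be extracted from the
  -- complexity hypothesis; it is what makes being a factor decidable.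
  module FiniteFactors (before : ∀ ℓ → ∃ (OccurBefore ℓ)) where

    factors : ∀ ℓ → List (Vec (Fin k) ℓ)
    factors ℓ = deduplicate _≟ᵛ_ (map (λ i → factorAt i ℓ) (upTo (proj₁ (before ℓ))))

    complexity : ℕ → ℕ
    complexity ℓ = length (factors ℓ)

    factors-unique : ∀ ℓ → Unique (factors ℓ)
    factors-unique ℓ = deduplicate-! _≟ᵛ_ _

    ∈-factors⁻ : ∀ {ℓ} {v : Vec (Fin k) ℓ} → v ∈ factors ℓ → IsFactor x v
    ∈-factors⁻ {ℓ} v∈ with i , _ , refl ← ∈-map⁻ (λ i → factorAt i ℓ) (∈-deduplicate⁻ _≟ᵛ_ _ v∈) =
      factorAt-isFactor i ℓ

    ∈-factors⁺ : ∀ {ℓ} {v : Vec (Fin k) ℓ} → IsFactor x v → v ∈ factors ℓ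
    ∈-factors⁺ {ℓ} {v} f with i , refl ← isFactor⇒factorAt {v = v} f
                         with j , j<B , ag ← proj₂ (before ℓ) i =
      ∈-deduplicate⁺ _≟ᵛ_ (subst (_∈ _) (sym ag) (∈-map⁺ (λ i → factorAt i ℓ) (∈-upTo⁺ j<B)))

    complexity-minimal : ∀ {ℓ m} → Complexity x ℓ m → complexity ℓ ≤ m
    complexity-minimal (L , _ , refl , L⇔) =
      Unique∧⊆⇒length≤ (factors-unique _) (λ v∈ → Equivalence.from (L⇔ _) (∈-factors⁻ v∈))

    isFactor? : ∀ {ℓ} (v : Vec (Fin k) ℓ) → Dec (IsFactor x v)
    isFactor? v = map′ ∈-factors⁻ ∈-factors⁺ (DecMembership._∈?_ _≟ᵛ_ v (factors _))

    rightSpecial? : ∀ {ℓ} (v : Vec (Fin k) ℓ) → Dec (RightSpecial x v)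
    rightSpecial? v =
      any? λ c → any? λ d → ¬? (c ≟ᶠ d) ×-dec isFactor? (v ∷ʳ c) ×-dec isFactor? (v ∷ʳ d)

    factorAt-∈-factors : ∀ i ℓ → factorAt i ℓ ∈ factors ℓ
    factorAt-∈-factors i ℓ = ∈-factors⁺ (factorAt-isFactor i ℓ)

    factorIndex : ∀ {ℓ} → Fin (suc (complexity ℓ)) → Fin (complexity ℓ)
    factorIndex {ℓ} t = index (factorAt-∈-factors (toℕ t) ℓ)

    factor-repeats : ∀ ℓ → ∃₂ λ s t → s < t × Agree ℓ s t
    factor-repeats ℓ with s , t , s<t , eq ← pigeonhole (n<1+n (complexity ℓ)) factorIndex =
      toℕ s , toℕ t , s<t ,
      index-injective (setoid _) (factorAt-∈-factors (toℕ s) ℓ) (factorAt-∈-factors (toℕ t) ℓ) eq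

    rightSpecialAt-exists : ¬ UltimatelyPeriodic x → ∀ ℓ → ∃₂ (RightSpecialAt ℓ)
    rightSpecialAt-exists aperiodic ℓ with Any.any? rightSpecial? (factors ℓ)
    ... | yes some with v , rs ← satisfied some
                   with i , j , _ , r ← rightSpecial⇒rightSpecialAt {v = v} rs = i , j , r
    ... | no none with s , t , s<t , ag ← factor-repeats ℓ =
      ⊥-elim (aperiodic (determined⇒ultimatelyPeriodic determined s<t ag))
      where
      determined : ∀ {i j} → Agree ℓ i j → x (i + ℓ) ≡ x (j + ℓ)
      determined {i} {j} ag with x (i + ℓ) ≟ᶠ x (j + ℓ)
      ... | yes e = e
      ... | no ≢  = ⊥-elim (none (lose (factorAt-∈-factors i ℓ) (rightSpecialAt⇒rightSpecial (ag , ≢))))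

    twoRightSpecials? : ∀ ℓ → Dec (TwoRightSpecials ℓ)
    twoRightSpecials? ℓ = map′ from to (Any.any? (λ u → Any.any? (two? u) (factors ℓ)) (factors ℓ))
      where
      Two : Vec (Fin k) ℓ → Vec (Fin k) ℓ → Set
      Two u v = u ≢ v × RightSpecial x u × RightSpecial x v
      two? : ∀ u v → Dec (Two u v)
      two? u v = ¬? (u ≟ᵛ v) ×-dec rightSpecial? u ×-dec rightSpecial? v
      from : Any (λ u → Any (Two u) (factors ℓ)) (factors ℓ) → TwoRightSpecials ℓ
      from some with u , some′ ← satisfied some with v , two ← satisfied some′ = u , v , two
      to : TwoRightSpecials ℓ → Any (λ u → Any (Two u) (factors ℓ)) (factors ℓ)
      to (u , v , two@(_ , ru , rv)) = lose (∈-factors⁺ (rightSpecial⇒isFactor {v = u} ru))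
                                             (lose (∈-factors⁺ (rightSpecial⇒isFactor {v = v} rv)) two)

    rightExtension : ∀ {ℓ} → Vec (Fin k) ℓ → Fin k
    rightExtension u with any? (λ c → isFactor? (u ∷ʳ c))
    ... | yes (c , _) = c
    ... | no _        = x 0   -- junk value on non-factors; no constant letter exists when k = 0

    isFactor-rightExtension : ∀ {ℓ} {u : Vec (Fin k) ℓ} → IsFactor x u →
                              IsFactor x (u ∷ʳ rightExtension u)
    isFactor-rightExtension {u = u} f with any? (λ c → isFactor? (u ∷ʳ c))
    ... | yes (_ , fc) = fc
    ... | no none      = ⊥-elim (none (isFactor-extendable {v = u} f))

    otherExtension : ∀ {ℓ} {u : Vec (Fin k) ℓ} → RightSpecial x u →
                     ∃ λ c → c ≢ rightExtension u × IsFactor x (u ∷ʳ c)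
    otherExtension {u = u} (c , d , c≢d , fc , fd) with c ≟ᶠ rightExtension u
    ... | yes refl = d , (λ d≡ → c≢d (sym d≡)) , fd
    ... | no c≢    = c , c≢ , fc

    extend : ∀ {ℓ} → Vec (Fin k) ℓ → Vec (Fin k) (suc ℓ)
    extend u = u ∷ʳ rightExtension u

    -- The factors of length ℓ + 1 include one extension of every factor of length ℓ and a second
    -- extension of each of the two right-special ones.
    twoRightSpecials⇒growth : ∀ {ℓ} → TwoRightSpecials ℓ → 2 + complexity ℓ ≤ complexity (suc ℓ)
    twoRightSpecials⇒growth {ℓ} (u , v , u≢v , ru , rv)
      with c , c≢ , fc ← otherExtension {u = u} ru | d , d≢ , fd ← otherExtension {u = v} rv =
      subst (_≤ complexity (suc ℓ)) (cong (2 +_) (length-map extend (factors ℓ)))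
        (Unique∧⊆⇒length≤ unique sub)
      where
      extended : List (Vec (Fin k) (suc ℓ))
      extended = map extend (factors ℓ)

      extra∉ : ∀ {w : Vec (Fin k) ℓ} {e} → e ≢ rightExtension w → w ∷ʳ e ∉ extended
      extra∉ {w} e≢ w∈ with y , _ , eq ← ∈-map⁻ extend w∈
                       with refl , refl ← ∷ʳ-injective w y eq = e≢ refl

      unique : Unique ((u ∷ʳ c) ∷ (v ∷ʳ d) ∷ extended)
      unique = ((λ eq → u≢v (∷ʳ-injectiveˡ u v eq)) ∷ ¬Any⇒All¬ _ (extra∉ c≢))
             ∷ ¬Any⇒All¬ _ (extra∉ d≢)
             ∷ map⁺ (∷ʳ-injectiveˡ _ _) (factors-unique ℓ)

      sub : (u ∷ʳ c) ∷ (v ∷ʳ d) ∷ extended ⊆ factors (suc ℓ)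
      sub (here refl)         = ∈-factors⁺ fc
      sub (there (here refl)) = ∈-factors⁺ fd
      sub (there (there w∈)) with y , y∈ , refl ← ∈-map⁻ extend w∈ =
        ∈-factors⁺ (isFactor-rightExtension {u = y} (∈-factors⁻ y∈))

    complexity-lowerBound : ∀ {n} D → (∀ {d} → d < D → TwoRightSpecials (d + n)) →
                            2 * D ≤ complexity (D + n)
    complexity-lowerBound zero    _   = z≤n
    complexity-lowerBound {n} (suc D) two = begin
      2 * suc D              ≡⟨ *-suc 2 D ⟩
      2 + 2 * D              ≤⟨ +-monoʳ-≤ 2 (complexity-lowerBound D (λ d<D → two (m≤n⇒m≤1+n d<D))) ⟩
      2 + complexity (D + n) ≤⟨ twoRightSpecials⇒growth (two ≤-refl) ⟩
      complexity (suc D + n) ∎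
      where open ≤-Reasoning

    -- If every length in [n, N) had two right-special factors, then p(N) ≥ 2(N ∸ n), contradicting
    -- b p(N) < a N since a < 2b and N ≥ (a + 1) n.
    atMostOneRightSpecial-beyond : LiminfComplexityRatioLt2 x →
                                   ∀ n → ∃ λ d → AtMostOneRightSpecial (d + n)
    atMostOneRightSpecial-beyond (a , b , _ , a<2b , often) n
      with N , an+n≤N , _ , m , cx , bm<aN ← often (a * n + n)
      with anyUpTo? (λ d → ¬? (twoRightSpecials? (d + n))) (N ∸ n)
    ... | yes (d , _ , ¬two) = d , ¬twoRightSpecials⇒atMostOne ¬two
    ... | no none = ⊥-elim (<⇒≱ bm<aN (subst (λ N → a * N ≤ b * m) D+n≡N
                      (a*[D+n]≤b*m {b = b} a<2b (m+n≤o⇒m≤o∸n (a * n) an+n≤N) 2D≤m)))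
      where
      D : ℕ
      D = N ∸ n
      D+n≡N : D + n ≡ N
      D+n≡N = m∸n+n≡m (≤-trans (m≤n+m n (a * n)) an+n≤N)
      two : ∀ {d} → d < D → TwoRightSpecials (d + n)
      two d<D = decidable-stable (twoRightSpecials? _) (λ ¬two → none (_ , d<D , ¬two))
      2D≤m : 2 * D ≤ m
      2D≤m = ≤-trans (complexity-lowerBound D two)
                     (complexity-minimal (subst (λ N → Complexity x N m) (sym D+n≡N) cx))

  module SuffixOfUniqueRightSpecial {d n i₀ j₀ : ℕ} (atMostOne : AtMostOneRightSpecial (d + n))
                                    (r₀ : RightSpecialAt (d + n) i₀ j₀) where

    w : Vec (Fin k) n
    w = factorAt (i₀ + d) n

    rightSpecialAt-suffix≡w : ∀ {m i j} → d ≤ m → RightSpecialAt (m + n) i j → factorAt (i + m) n ≡ w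
    rightSpecialAt-suffix≡w {i = i} {j} d≤m r with o , refl ← m≤n⇒∃[o]m+o≡n d≤m = begin
      factorAt (i + (d + o)) n ≡⟨ cong (λ p → factorAt p n) (shuffle₁ i d o) ⟩
      factorAt ((i + o) + d) n ≡⟨ Agree-suffix d (atMostOne (rightSpecialAt⇒rightSpecial r′)
                                                           (rightSpecialAt⇒rightSpecial r₀)) ⟩
      w                        ∎
      where
      open ≡-Reasoning
      shuffle₁ : ∀ i d o → i + (d + o) ≡ (i + o) + d
      shuffle₁ = solve-∀
      shuffle₂ : ∀ d o n → (d + o) + n ≡ o + (d + n)
      shuffle₂ = solve-∀
      r′ : RightSpecialAt (d + n) (i + o) (j + o)
      r′ = RightSpecialAt-suffix o (subst (λ ℓ → RightSpecialAt ℓ i j) (shuffle₂ d o n) r)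

    w-essential : (∀ ℓ → ∃₂ (RightSpecialAt ℓ)) → EssentialRightSpecial x w
    w-essential existence = rightSpecialAt⇒rightSpecial (RightSpecialAt-suffix d r₀) , long
      where
      long : ∀ L → ∃ λ m → Σ (Vec (Fin k) m) λ u → L ≤ m + n × RightSpecial x (u ++ w)
      long L with i , j , r ← existence ((L + d) + n) =
        L + d , factorAt i (L + d) , ≤-trans (m≤m+n L d) (m≤m+n (L + d) n) ,
        subst (RightSpecial x) u++w≡ (rightSpecialAt⇒rightSpecial r)
        where
        u++w≡ : factorAt i ((L + d) + n) ≡ factorAt i (L + d) ++ w
        u++w≡ = trans (sym (factorAt-++ i (L + d) n))
                      (cong (factorAt i (L + d) ++_) (rightSpecialAt-suffix≡w (m≤n+m d L) r))

    essential⇒≡w : ∀ {w′ : Vec (Fin k) n} → EssentialRightSpecial x w′ → w′ ≡ w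
    essential⇒≡w {w′} (_ , long) with m , u , d+n≤m+n , rs ← long (d + n)
      with i , j , u++w′≡ , r ← rightSpecial⇒rightSpecialAt {v = u ++ w′} rs = begin
      w′                 ≡⟨ ++-injectiveʳ u (factorAt i m) (trans u++w′≡ (sym (factorAt-++ i m n))) ⟩
      factorAt (i + m) n ≡⟨ rightSpecialAt-suffix≡w (+-cancelʳ-≤ n d m d+n≤m+n) r ⟩
      w                  ∎
      where open ≡-Reasoning

lemma2p10 : (k : ℕ) (x : Word k) → ¬ UltimatelyPeriodic x → LiminfComplexityRatioLt2 x →
            (n : ℕ) → 1 ≤ n →
            Σ (Vec (Fin k) n) λ w → EssentialRightSpecial x w ×
              (∀ (w′ : Vec (Fin k) n) → EssentialRightSpecial x w′ → w′ ≡ w)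
lemma2p10 k x aperiodic liminf n _ =
  let open FiniteFactors x (liminf⇒occurBefore x liminf)
      d , atMostOne = atMostOneRightSpecial-beyond liminf n
      _ , _ , r₀    = rightSpecialAt-exists aperiodic (d + n)
      open SuffixOfUniqueRightSpecial x {d} {n} atMostOne r₀
  in w , w-essential (rightSpecialAt-exists aperiodic) , λ _ → essential⇒≡w
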